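{- Let $p\ge3$ be an integer, $u$ an integer coprime to $p$, and $r_1$ the integer with $0<r_1<p$ and $ur_1\equiv1\pmod p$. Put $r_0=p$ and for $1\le i\le t$ define integers $Z_i$, $r_{i+1}$ by $r_{i-1}=Z_ir_i+r_{i+1}$, $0\le r_{i+1}<r_i$, where $t$ is the index with $r_t=1$. Let $a<b$ be integers with $1<b-a<p$ such that $$\max(\langle ua\rangle_p,\langle ub\rangle_p)<\min_{a<n<b}\langle un\rangle_p,$$ and suppose $\langle ua\rangle_p<\langle ub\rangle_p$. Then $b-a=r_{2k-1}-zr_{2k}$ for some integer $k\ge1$ with $2k\le t$ and some $0\le z\le Z_{2k}-1$.
   Context: $\langle x\rangle_p$ denotes the least nonnegative residue of the integer $x$ modulo $p$. -}

module Defs where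

open import Data.Nat using (ℕ; zero; suc; _∸_)
open import Data.Nat.DivMod using (_%_; _/_)
open import Data.Integer using (ℤ; _%ℕ_)
open import Data.Product using (_×_; _,_; proj₁; proj₂)

-- ⟨ x ⟩ p : the least nonnegative residue of the integer x modulo p
-- (for p = 0 the value is irrelevant; we set it to 0).
⟨_⟩_ : ℤ → ℕ → ℕ
⟨ x ⟩ zero    = 0
⟨ x ⟩ (suc q) = x %ℕ suc q

_rem_ : ℕ → ℕ → ℕ
m rem zero    = m
m rem (suc q) = m % suc q

_quot_ : ℕ → ℕ → ℕ
m quot zero    = 0
m quot (suc q) = m / suc q

-- consecutive pairs (r_i , r_{i+1}) of the Euclidean remainder sequence
-- started with r_0 = p, r_1 = r1 :  r_{i-1} = Z_i r_i + r_{i+1}, 0 ≤ r_{i+1} < r_i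
rpair : ℕ → ℕ → ℕ → ℕ × ℕ
rpair p r1 zero    = p , r1
rpair p r1 (suc i) = proj₂ (rpair p r1 i) , (proj₁ (rpair p r1 i) rem proj₂ (rpair p r1 i))

r : ℕ → ℕ → ℕ → ℕ
r p r1 i = proj₁ (rpair p r1 i)

Z : ℕ → ℕ → ℕ → ℕ
Z p r1 i = r p r1 (i ∸ 1) quot r p r1 i

{-# OPTIONS --safe #-}
-- Put X = ⟨u a⟩, Y = ⟨u b⟩, S = Y − X > 0 and d = b − a. As u r₁ ≡ 1 (mod p), the point (S , d)
-- lies on the lattice Λ = {(x , y) | y ≡ r₁ x (mod p)}, and the gap hypothesis says that Λ has no
-- point (x , y) with 0 ≤ x ≤ S and 0 < y < d: for n = a + y it would give ⟨u n⟩ = X + x ≤ Y.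
-- The extended Euclidean algorithm yields cofactors sᵢ with (sᵢ , rᵢ) ∈ Λ for odd i, (−sᵢ , rᵢ) ∈ Λ
-- for even i, and sᵢ₊₁ rᵢ + sᵢ rᵢ₊₁ = p. Take the odd index o = 2k − 1 with rₒ₊₂ < d ≤ rₒ, and
-- z < Z₂ₖ with y := rₒ − (z + 1) r₂ₖ < d ≤ y + r₂ₖ. Then v = (sₒ + (z + 1) s₂ₖ , y) and
-- w = (−s₂ₖ , r₂ₖ) span a parallelogram of area p, so (S , d) = γ v + α w with γ ≥ 1. If α ≤ 0 then
-- S ≥ sₒ + (z + 1) s₂ₖ while 0 < y < d, against the gap; so α ≥ 1 and d ≥ y + r₂ₖ = rₒ − z r₂ₖ.
module Submission where

open import Defs
open import Data.Nat using (ℕ; _≤_; _<_; _⊔_; _*_; _∸_; suc)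
open import Data.Nat.Coprimality using (Coprime)
open import Data.Integer using (ℤ; +_; ∣_∣) renaming (_*_ to _*ℤ_; _-_ to _-ℤ_; _<_ to _<ℤ_; _+_ to _+ℤ_)
open import Data.Integer.Divisibility using () renaming (_∣_ to _∣ℤ_)
open import Data.Product using (Σ; _×_; _,_)
open import Relation.Binary.PropositionalEquality using (_≡_)

open import Data.Nat using (zero; _+_; z≤n; s≤s; z<s; _%_; _≤?_; _<?_; NonZero; >-nonZero; ≢-nonZero⁻¹)
open import Data.Nat.Properties
open import Data.Nat.DivMod using (m≡m%n+[m/n]*n; n%1≡0)
open import Data.Nat.Divisibility using (∣⇒≤; >⇒∤)
open import Data.Nat.Tactic.RingSolver using (solve; solve-∀)
open import Data.Integer using (-_; 0ℤ; 1ℤ; +<+; _/ℕ_)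
import Data.Integer.Properties as ℤ
open import Data.Integer.DivMod using (a≡a%ℕn+[a/ℕn]*n; n%ℕd<d)
open import Data.Integer.Divisibility.Signed
  using (_∣_; divides; ∣ᵤ⇒∣; ∣⇒∣ᵤ; ∣m∣n⇒∣m+n; ∣m∣n⇒∣m-n; ∣n⇒∣m*n)
open import Data.Integer.Tactic.RingSolver using () renaming (solve to solveℤ; solve-∀ to solveℤ-∀)
open import Data.List using (_∷_; [])
open import Data.Product using (∃-syntax; ∃₂; proj₁; proj₂)
open import Data.Empty using (⊥-elim)
open import Relation.Binary.PropositionalEquality
  using (refl; sym; trans; cong; cong₂; subst; subst₂; module ≡-Reasoning)
open import Relation.Nullary using (¬_; yes; no)
open import Relation.Unary using (Decidable)

+m-+n≡+[m∸n] : ∀ {m n} → n ≤ m → + m -ℤ + n ≡ + (m ∸ n)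
+m-+n≡+[m∸n] {m} {n} n≤m = trans (ℤ.m-n≡m⊖n m n) (ℤ.⊖-≥ n≤m)

pos-+* : ∀ m n k → + (m + n * k) ≡ + m +ℤ + n *ℤ + k
pos-+* m n k = trans (ℤ.pos-+ m (n * k)) (cong (+ m +ℤ_) (ℤ.pos-* n k))

i-k*-j≡i+k*j : ∀ i k j → i -ℤ k *ℤ (- j) ≡ i +ℤ k *ℤ j
i-k*-j≡i+k*j = solveℤ-∀

m≡n*k+o⇒+o≡+m-+n*+k : ∀ {m o} n k → m ≡ n * k + o → + o ≡ + m -ℤ + n *ℤ + k
m≡n*k+o⇒+o≡+m-+n*+k {o = o} n k refl = begin
  + o                                ≡⟨ identity (+ o) (+ n *ℤ + k) ⟩
  (+ n *ℤ + k +ℤ + o) -ℤ + n *ℤ + k  ≡⟨ cong (λ a → (a +ℤ + o) -ℤ + n *ℤ + k) (ℤ.pos-* n k) ⟨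
  (+ (n * k) +ℤ + o) -ℤ + n *ℤ + k   ≡⟨ cong (_-ℤ + n *ℤ + k) (ℤ.pos-+ (n * k) o) ⟨
  + (n * k + o) -ℤ + n *ℤ + k        ∎
  where
  open ≡-Reasoning
  identity : ∀ a b → a ≡ (b +ℤ a) -ℤ b
  identity = solveℤ-∀

∣m-n⇒≤m∸n : ∀ {p m n} → + p ∣ + m -ℤ + n → n < m → p ≤ m ∸ n
∣m-n⇒≤m∸n {p} p∣m-n n<m =
  ∣⇒≤ {{>-nonZero (m<n⇒0<n∸m n<m)}} (∣⇒∣ᵤ (subst (+ p ∣_) (+m-+n≡+[m∸n] (<⇒≤ n<m)) p∣m-n))

+m≡+n[mod-p]⇒m≡n : ∀ {p m n} → m < p → n < p → + p ∣ + m -ℤ + n → m ≡ n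
+m≡+n[mod-p]⇒m≡n {p} {m} {n} m<p n<p p∣m-n =
  ℤ.+-injective (ℤ.i-j≡0⇒i≡j (+ m) (+ n) (ℤ.∣i∣≡0⇒i≡0 ∣m-n∣≡0))
  where
  ∣m-n∣<p : ∣ + m -ℤ + n ∣ < p
  ∣m-n∣<p = ≤-<-trans (subst (_≤ m ⊔ n) (cong ∣_∣ (sym (ℤ.m-n≡m⊖n m n))) (ℤ.∣m⊝n∣≤m⊔n m n))
                      (⊔-lub m<p n<p)
  ∣m-n∣≡0 : ∣ + m -ℤ + n ∣ ≡ 0
  ∣m-n∣≡0 with ∣ + m -ℤ + n ∣ | ∣⇒∣ᵤ p∣m-n | ∣m-n∣<p
  ... | zero  | _   | _   = refl
  ... | suc k | p∣k | k<p = ⊥-elim (>⇒∤ k<p p∣k)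

module _ {q : ℕ} where

  ⟨⟩-congruence : ∀ z → + suc q ∣ z -ℤ + ⟨ z ⟩ suc q
  ⟨⟩-congruence z = divides (z /ℕ suc q)
    (trans (cong (_-ℤ + ⟨ z ⟩ suc q) (a≡a%ℕn+[a/ℕn]*n z (suc q))) (identity (+ ⟨ z ⟩ suc q) _))
    where
    identity : ∀ a b → (a +ℤ b) -ℤ a ≡ b
    identity = solveℤ-∀

  ⟨⟩-unique : ∀ {m} z → m < suc q → + suc q ∣ z -ℤ + m → ⟨ z ⟩ suc q ≡ m
  ⟨⟩-unique {m} z m<p p∣z-m =
    +m≡+n[mod-p]⇒m≡n (n%ℕd<d z (suc q)) m<p
      (subst (+ suc q ∣_) (identity z _ _) (∣m∣n⇒∣m-n p∣z-m (⟨⟩-congruence z)))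
    where
    identity : ∀ a b c → (a -ℤ c) -ℤ (a -ℤ b) ≡ b -ℤ c
    identity = solveℤ-∀

record Λ (m c x y : ℤ) : Set where
  constructor mkΛ
  field m∣y-cx : m ∣ y -ℤ c *ℤ x

module _ {m c : ℤ} where

  Λ-0m : Λ m c 0ℤ m
  Λ-0m = mkΛ (divides 1ℤ identity)
    where
    identity : m -ℤ c *ℤ 0ℤ ≡ 1ℤ *ℤ m
    identity = solveℤ (m ∷ c ∷ [])

  Λ-1c : Λ m c 1ℤ c
  Λ-1c = mkΛ (divides 0ℤ identity)
    where
    identity : c -ℤ c *ℤ 1ℤ ≡ 0ℤ *ℤ m
    identity = solveℤ (m ∷ c ∷ [])

  Λ-sub-mul : ∀ {x y x′ y′} → Λ m c x y → Λ m c x′ y′ →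
              ∀ k → Λ m c (x -ℤ k *ℤ x′) (y -ℤ k *ℤ y′)
  Λ-sub-mul {x} {y} {x′} {y′} (mkΛ h) (mkΛ h′) k =
    mkΛ (subst (m ∣_) identity (∣m∣n⇒∣m-n h (∣n⇒∣m*n k h′)))
    where
    identity : (y -ℤ c *ℤ x) -ℤ k *ℤ (y′ -ℤ c *ℤ x′) ≡ (y -ℤ k *ℤ y′) -ℤ c *ℤ (x -ℤ k *ℤ x′)
    identity = solveℤ (c ∷ k ∷ x ∷ y ∷ x′ ∷ y′ ∷ [])

  Λ-det : ∀ {x y x′ y′} → Λ m c x y → Λ m c x′ y′ → m ∣ x *ℤ y′ -ℤ x′ *ℤ y
  Λ-det {x} {y} {x′} {y′} (mkΛ h) (mkΛ h′) =
    subst (m ∣_) identity (∣m∣n⇒∣m-n (∣n⇒∣m*n x h′) (∣n⇒∣m*n x′ h))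
    where
    identity : x *ℤ (y′ -ℤ c *ℤ x′) -ℤ x′ *ℤ (y -ℤ c *ℤ x) ≡ x *ℤ y′ -ℤ x′ *ℤ y
    identity = solveℤ (c ∷ x ∷ y ∷ x′ ∷ y′ ∷ [])

crossing : ∀ {P : ℕ → Set} → Decidable P → P 0 → ∀ {n} → ¬ P n →
           ∃[ k ] k < n × P k × ¬ P (suc k)
crossing P? P0 {zero}  ¬P0   = ⊥-elim (¬P0 P0)
crossing P? P0 {suc n} ¬Pn+1 with P? n
... | yes Pn  = n , ≤-refl , Pn , ¬Pn+1
... | no  ¬Pn = let k , k<n , Pk , ¬Pk+1 = crossing P? P0 ¬Pn
                in  k , m<n⇒m<1+n k<n , Pk , ¬Pk+1

division-crossing : ∀ {q m ρ d} → ρ < d → d ≤ q * m + ρ →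
                    ∃₂ λ z y → suc z ≤ q × q * m + ρ ≡ suc z * m + y × y < d × d ≤ y + m
division-crossing {q} {m} {ρ} {d} ρ<d d≤qm+ρ
  with n , n<q , y<d , ¬Pn+1 ← crossing (λ n → n * m + ρ <? d) ρ<d (≤⇒≯ d≤qm+ρ)
  with z , n+1+z≡q ← m≤n⇒∃[o]m+o≡n n<q
  = z , n * m + ρ , subst (suc z ≤_) n+1+z≡q (s≤s (m≤n+m z n)) , split , y<d , d≤y+m
  where
  split : q * m + ρ ≡ suc z * m + (n * m + ρ)
  split = trans (cong (λ a → a * m + ρ) (sym n+1+z≡q)) (identity n z m ρ)
    where
    identity : ∀ n z m ρ → (suc n + z) * m + ρ ≡ suc z * m + (n * m + ρ)
    identity = solve-∀
  d≤y+m : d ≤ n * m + ρ + m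
  d≤y+m = subst (d ≤_) (identity n m ρ) (≮⇒≥ ¬Pn+1)
    where
    identity : ∀ n m ρ → suc n * m + ρ ≡ n * m + ρ + m
    identity = solve-∀

-- Multiplying Cramer's rule for (S , d) = γ (x , y) + α (−s , r) by p = x r + s y gives
-- S p + s (x d) = x (S r + s d) + s (y S) and d p + r (y S) = y (S r + s d) + r (x d),
-- where p divides both S r + s d = γ p > 0 and x d − y S = α p; the sign of α decides.
module _ {c : ℤ} {p x y s r S d : ℕ} .{{_ : NonZero p}}
         (v : Λ (+ p) c (+ x) (+ y)) (w : Λ (+ p) c (- + s) (+ r)) (area : x * r + s * y ≡ p)
         (P : Λ (+ p) c (+ S) (+ d)) (0<S : 0 < S) (y<d : y < d) (d≤y+r : d ≤ y + r) where

  private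
    p≤det : p ≤ S * r + s * d
    p≤det = ∣⇒≤ {{>-nonZero 0<det}} (∣⇒∣ᵤ (subst (+ p ∣_) det≡ (Λ-det P w)))
      where
      0<r : 0 < r
      0<r = +-cancelˡ-< y 0 r (subst (_< y + r) (sym (+-identityʳ y)) (<-≤-trans y<d d≤y+r))
      0<det : 0 < S * r + s * d
      0<det = ≤-trans (*-mono-≤ 0<S 0<r) (m≤m+n (S * r) (s * d))
      identity : ∀ a b c d → a *ℤ b -ℤ (- c) *ℤ d ≡ a *ℤ b +ℤ c *ℤ d
      identity = solveℤ-∀
      det≡ : + S *ℤ + r -ℤ (- + s) *ℤ + d ≡ + (S * r + s * d)
      det≡ = trans (identity (+ S) (+ r) (+ s) (+ d))
                (sym (trans (ℤ.pos-+ (S * r) (s * d)) (cong₂ _+ℤ_ (ℤ.pos-* S r) (ℤ.pos-* s d))))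

    open ≤-Reasoning

    above : y * S < x * d → y + r ≤ d
    above yS<xd = *-cancelʳ-≤ (y + r) d p (+-cancelʳ-≤ (r * (y * S)) _ _ (begin
      (y + r) * p + r * (y * S)          ≡⟨ solve (y ∷ r ∷ p ∷ S ∷ []) ⟩
      y * p + r * (p + y * S)            ≤⟨ +-mono-≤ (*-monoʳ-≤ y p≤det) (*-monoʳ-≤ r p+yS≤xd) ⟩
      y * (S * r + s * d) + r * (x * d)  ≡⟨ solve (x ∷ y ∷ s ∷ r ∷ S ∷ d ∷ []) ⟨
      (x * r + s * y) * d + r * (y * S)  ≡⟨ cong (λ a → a * d + r * (y * S)) area ⟩
      p * d + r * (y * S)                ≡⟨ cong (_+ r * (y * S)) (*-comm p d) ⟩
      d * p + r * (y * S)                ∎))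
      where
      det : + x *ℤ + d -ℤ + S *ℤ + y ≡ + (x * d) -ℤ + (y * S)
      det = cong₂ _-ℤ_ (sym (ℤ.pos-* x d)) (trans (ℤ.*-comm (+ S) (+ y)) (sym (ℤ.pos-* y S)))
      p+yS≤xd : p + y * S ≤ x * d
      p+yS≤xd = subst (p + y * S ≤_) (m∸n+n≡m (<⇒≤ yS<xd))
                  (+-monoˡ-≤ (y * S) (∣m-n⇒≤m∸n (subst (+ p ∣_) det (Λ-det v P)) yS<xd))

    not-above : x * d ≤ y * S → 0 < y × x ≤ S
    not-above xd≤yS = 0<y , *-cancelʳ-≤ x S p (+-cancelʳ-≤ (s * (x * d)) _ _ (begin
      x * p + s * (x * d)                ≤⟨ +-mono-≤ (*-monoʳ-≤ x p≤det) (*-monoʳ-≤ s xd≤yS) ⟩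
      x * (S * r + s * d) + s * (y * S)  ≡⟨ solve (x ∷ y ∷ s ∷ r ∷ S ∷ d ∷ []) ⟨
      (x * r + s * y) * S + s * (x * d)  ≡⟨ cong (λ a → a * S + s * (x * d)) area ⟩
      p * S + s * (x * d)                ≡⟨ cong (_+ s * (x * d)) (*-comm p S) ⟩
      S * p + s * (x * d)                ∎))
      where
      x≡0 : y ≡ 0 → x ≡ 0
      x≡0 y≡0 = m*n≡0⇒m≡0 x d {{>-nonZero (≤-<-trans z≤n y<d)}}
                  (n≤0⇒n≡0 (subst (λ b → x * d ≤ b * S) y≡0 xd≤yS))
      0<y : 0 < y
      0<y = n≢0⇒n>0 λ y≡0 → ≢-nonZero⁻¹ p (begin-equality
        p              ≡⟨ area ⟨
        x * r + s * y  ≡⟨ cong₂ (λ a b → a * r + s * b) (x≡0 y≡0) y≡0 ⟩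
        0 * r + s * 0  ≡⟨ cong (λ b → 0 + b) (*-zeroʳ s) ⟩
        0              ∎)

  lattice-point-on-top-edge : (0 < y → S < x) → d ≡ y + r
  lattice-point-on-top-edge below with y * S <? x * d
  ... | yes yS<xd = ≤-antisym d≤y+r (above yS<xd)
  ... | no  yS≮xd = let 0<y , x≤S = not-above (≮⇒≥ yS≮xd)
                    in  ⊥-elim (<⇒≱ (below 0<y) x≤S)

m≡[m-quot-n]*n+m-rem-n : ∀ m n → m ≡ (m quot n) * n + m rem n
m≡[m-quot-n]*n+m-rem-n m zero    = refl
m≡[m-quot-n]*n+m-rem-n m (suc n) = trans (m≡m%n+[m/n]*n m (suc n)) (+-comm (m % suc n) _)

m≤1∧n≤1⇒m-rem-n≤1 : ∀ {m n} → m ≤ 1 → n ≤ 1 → m rem n ≤ 1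
m≤1∧n≤1⇒m-rem-n≤1 {m} {zero}        m≤1 _         = m≤1
m≤1∧n≤1⇒m-rem-n≤1 {m} {suc zero}    _   _         = subst (_≤ 1) (sym (n%1≡0 m)) z≤n
m≤1∧n≤1⇒m-rem-n≤1 {m} {suc (suc n)} _   (s≤s ())

module _ (p r₁ : ℕ) where

  r-recurrence : ∀ i → r p r₁ i ≡ Z p r₁ (suc i) * r p r₁ (suc i) + r p r₁ (suc (suc i))
  r-recurrence i = m≡[m-quot-n]*n+m-rem-n (r p r₁ i) (r p r₁ (suc i))

  s : ℕ → ℕ
  s zero          = 0
  s (suc zero)    = 1
  s (suc (suc i)) = s i + Z p r₁ (suc i) * s (suc i)

  s-det : ∀ i → s (suc i) * r p r₁ i + s i * r p r₁ (suc i) ≡ p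
  s-det zero    = trans (+-identityʳ (p + 0)) (+-identityʳ p)
  s-det (suc i) = begin
    (sᵢ + Zᵢ₊₁ * sᵢ₊₁) * rᵢ₊₁ + sᵢ₊₁ * r p r₁ (2 + i)  ≡⟨ regroup sᵢ Zᵢ₊₁ sᵢ₊₁ rᵢ₊₁ _ ⟩
    sᵢ₊₁ * (Zᵢ₊₁ * rᵢ₊₁ + r p r₁ (2 + i)) + sᵢ * rᵢ₊₁  ≡⟨ cong (λ a → sᵢ₊₁ * a + sᵢ * rᵢ₊₁) (r-recurrence i) ⟨
    sᵢ₊₁ * r p r₁ i + sᵢ * rᵢ₊₁                         ≡⟨ s-det i ⟩
    p                                                   ∎
    where
    open ≡-Reasoning
    sᵢ = s i
    sᵢ₊₁ = s (suc i)
    rᵢ₊₁ = r p r₁ (suc i)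
    Zᵢ₊₁ = Z p r₁ (suc i)
    regroup : ∀ a z b c e → (a + z * b) * c + b * e ≡ b * (z * c + e) + a * c
    regroup = solve-∀

  r-recurrenceℤ : ∀ i →
                  + r p r₁ (suc (suc i)) ≡ + r p r₁ i -ℤ + Z p r₁ (suc i) *ℤ + r p r₁ (suc i)
  r-recurrenceℤ i = m≡n*k+o⇒+o≡+m-+n*+k (Z p r₁ (suc i)) (r p r₁ (suc i)) (r-recurrence i)

  s-recurrenceℤ : ∀ i → + s (suc (suc i)) ≡ + s i +ℤ + Z p r₁ (suc i) *ℤ + s (suc i)
  s-recurrenceℤ i = pos-+* (s i) (Z p r₁ (suc i)) (s (suc i))

  Λ-odd-step : ∀ i → Λ (+ p) (+ r₁) (+ s i) (+ r p r₁ i) →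
               Λ (+ p) (+ r₁) (- + s (suc i)) (+ r p r₁ (suc i)) →
               Λ (+ p) (+ r₁) (+ s (suc (suc i))) (+ r p r₁ (suc (suc i)))
  Λ-odd-step i wᵢ wᵢ₊₁ =
    subst₂ (Λ (+ p) (+ r₁)) x-step (sym (r-recurrenceℤ i)) (Λ-sub-mul wᵢ wᵢ₊₁ (+ Z p r₁ (suc i)))
    where
    x-step : + s i -ℤ + Z p r₁ (suc i) *ℤ - + s (suc i) ≡ + s (suc (suc i))
    x-step = trans (i-k*-j≡i+k*j (+ s i) (+ Z p r₁ (suc i)) (+ s (suc i)))
                   (sym (s-recurrenceℤ i))

  Λ-even-step : ∀ i → Λ (+ p) (+ r₁) (- + s i) (+ r p r₁ i) →
                Λ (+ p) (+ r₁) (+ s (suc i)) (+ r p r₁ (suc i)) →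
                Λ (+ p) (+ r₁) (- + s (suc (suc i))) (+ r p r₁ (suc (suc i)))
  Λ-even-step i wᵢ wᵢ₊₁ =
    subst₂ (Λ (+ p) (+ r₁)) x-step (sym (r-recurrenceℤ i)) (Λ-sub-mul wᵢ wᵢ₊₁ (+ Z p r₁ (suc i)))
    where
    identity : ∀ a z b → - a -ℤ z *ℤ b ≡ - (a +ℤ z *ℤ b)
    identity = solveℤ-∀
    x-step : - + s i -ℤ + Z p r₁ (suc i) *ℤ + s (suc i) ≡ - + s (suc (suc i))
    x-step = trans (identity (+ s i) (+ Z p r₁ (suc i)) (+ s (suc i)))
                   (cong -_ (sym (s-recurrenceℤ i)))

  Λ-pair : ℕ → Set
  Λ-pair n = Λ (+ p) (+ r₁) (+ s (suc n)) (+ r p r₁ (suc n))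
           × Λ (+ p) (+ r₁) (- + s (suc (suc n))) (+ r p r₁ (suc (suc n)))

  cofactor-lattice : ∀ k → Λ-pair (2 * k)
  cofactor-lattice zero    = Λ-1c , Λ-even-step 0 Λ-0m Λ-1c
  cofactor-lattice (suc k) =
    subst Λ-pair (sym (*-suc 2 k)) (odd , Λ-even-step (2 + 2 * k) even odd)
    where
    even = proj₂ (cofactor-lattice k)
    odd  = Λ-odd-step (1 + 2 * k) (proj₁ (cofactor-lattice k)) even

  r-≤1-pair : ∀ {i} → r p r₁ i ≤ 1 → r p r₁ (suc i) ≤ 1 →
              ∀ n → r p r₁ (n + i) ≤ 1 × r p r₁ (suc n + i) ≤ 1
  r-≤1-pair rᵢ≤1 rᵢ₊₁≤1 zero    = rᵢ≤1 , rᵢ₊₁≤1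
  r-≤1-pair rᵢ≤1 rᵢ₊₁≤1 (suc n) = let rₙ≤1 , rₙ₊₁≤1 = r-≤1-pair rᵢ≤1 rᵢ₊₁≤1 n
                                  in  rₙ₊₁≤1 , m≤1∧n≤1⇒m-rem-n≤1 rₙ≤1 rₙ₊₁≤1

  -- Once r t = 1 the sequence continues 0, 1, 0, 1, … since m rem 0 = m.
  r-≤1-after : ∀ {t} → 1 < p → r p r₁ t ≡ 1 → ∀ {i} → t ≤ i → r p r₁ i ≤ 1
  r-≤1-after {zero}  1<p p≡1 _ = ⊥-elim (<⇒≢ 1<p (sym p≡1))
  r-≤1-after {suc t} _ rₜ≡1 {i} t≤i =
    subst (λ j → r p r₁ j ≤ 1) (m∸n+n≡m t≤i)
          (proj₁ (r-≤1-pair (≤-reflexive rₜ≡1) rₜ₊₁≤1 (i ∸ suc t)))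
    where
    rₜ₊₁≤1 : r p r₁ t rem r p r₁ (suc t) ≤ 1
    rₜ₊₁≤1 = subst (λ n → r p r₁ t rem n ≤ 1) (sym rₜ≡1)
                   (subst (_≤ 1) (sym (n%1≡0 (r p r₁ t))) z≤n)

module _ {p r₁ t S d : ℕ} (1<p : 1 < p) (rₜ≡1 : r p r₁ t ≡ 1) (0<r₁ : 0 < r₁)
         (2≤d : 2 ≤ d) (0<S : 0 < S) (P : Λ (+ p) (+ r₁) (+ S) (+ d))
         (minimal : ∀ {x y} → 0 < y → y < d → x ≤ S → ¬ Λ (+ p) (+ r₁) (+ x) (+ y)) where

  private
    d≤r₁ : d ≤ r₁
    d≤r₁ = ≮⇒≥ λ r₁<d → minimal 0<r₁ r₁<d 0<S Λ-1c

    d≰r[1+2t] : ¬ d ≤ r p r₁ (1 + 2 * t)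
    d≰r[1+2t] = <⇒≱ (<-≤-trans (s≤s (r-≤1-after p r₁ 1<p rₜ≡1 t≤1+2t)) 2≤d)
      where
      t≤1+2t : t ≤ 1 + 2 * t
      t≤1+2t = ≤-trans (m≤m+n t _) (n≤1+n _)

    odd-crossing : ∃[ k ] d ≤ r p r₁ (1 + 2 * k) × r p r₁ (3 + 2 * k) < d
    odd-crossing
      with k , _ , d≤rₒ , d≰r ← crossing (λ k → d ≤? r p r₁ (1 + 2 * k)) d≤r₁ {t} d≰r[1+2t]
      = k , d≤rₒ , subst (λ i → r p r₁ (1 + i) < d) (*-suc 2 k) (≰⇒> d≰r)

    even-index-bound : ∀ k → d ≤ r p r₁ (1 + 2 * k) → 2 + 2 * k ≤ t
    even-index-bound k d≤rₒ =
      ≰⇒> λ t≤o → <⇒≱ (<-≤-trans (s≤s (r-≤1-after p r₁ 1<p rₜ≡1 t≤o)) 2≤d) d≤rₒ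

    intermediate-remainder : ∀ k → d ≤ r p r₁ (1 + 2 * k) → r p r₁ (3 + 2 * k) < d →
      ∃[ z ] suc z ≤ Z p r₁ (2 + 2 * k) × + d ≡ + r p r₁ (1 + 2 * k) -ℤ + z *ℤ + r p r₁ (2 + 2 * k)
    intermediate-remainder k d≤rₒ rₑ₊₁<d
      with z , y , suc-z≤Zₑ , Zₑrₑ+rₑ₊₁≡ , y<d , d≤y+rₑ
             ← division-crossing rₑ₊₁<d (subst (d ≤_) (r-recurrence p r₁ (1 + 2 * k)) d≤rₒ)
      = z , suc-z≤Zₑ , trans (cong +_ d≡y+rₑ) (m≡n*k+o⇒+o≡+m-+n*+k z rₑ (trans rₒ≡ (regroup z rₑ y)))
      where
      o = 1 + 2 * k
      rₑ = r p r₁ (suc o)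
      sₒ = s p r₁ o
      sₑ = s p r₁ (suc o)
      x = sₒ + suc z * sₑ
      wₒ = proj₁ (cofactor-lattice p r₁ k)
      wₑ = proj₂ (cofactor-lattice p r₁ k)
      regroup : ∀ z m y → suc z * m + y ≡ z * m + (y + m)
      regroup = solve-∀
      rₒ≡ : r p r₁ o ≡ suc z * rₑ + y
      rₒ≡ = trans (r-recurrence p r₁ o) Zₑrₑ+rₑ₊₁≡
      v : Λ (+ p) (+ r₁) (+ x) (+ y)
      v = subst₂ (Λ (+ p) (+ r₁)) x≡ y≡ (Λ-sub-mul wₒ wₑ (+ suc z))
        where
        x≡ : + sₒ -ℤ + suc z *ℤ - + sₑ ≡ + x
        x≡ = trans (i-k*-j≡i+k*j (+ sₒ) (+ suc z) (+ sₑ)) (sym (pos-+* sₒ (suc z) sₑ))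
        y≡ : + r p r₁ o -ℤ + suc z *ℤ + rₑ ≡ + y
        y≡ = sym (m≡n*k+o⇒+o≡+m-+n*+k (suc z) rₑ rₒ≡)
      area : x * rₑ + sₑ * y ≡ p
      area = begin
        (sₒ + suc z * sₑ) * rₑ + sₑ * y  ≡⟨ expand sₒ z sₑ rₑ y ⟩
        sₑ * (suc z * rₑ + y) + sₒ * rₑ  ≡⟨ cong (λ a → sₑ * a + sₒ * rₑ) rₒ≡ ⟨
        sₑ * r p r₁ o + sₒ * rₑ          ≡⟨ s-det p r₁ o ⟩
        p                                ∎
        where
        open ≡-Reasoning
        expand : ∀ a z b m y → (a + suc z * b) * m + b * y ≡ b * (suc z * m + y) + a * m
        expand = solve-∀
      d≡y+rₑ : d ≡ y + rₑ
      d≡y+rₑ = lattice-point-on-top-edge {{>-nonZero (<-trans z<s 1<p)}} v wₑ area P 0<S y<d d≤y+rₑ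
                 (λ 0<y → ≰⇒> λ x≤S → minimal 0<y y<d x≤S v)

    Claim : ℕ → ℕ → Set
    Claim k e = Σ ℕ λ z → 1 ≤ k × e ≤ t × suc z ≤ Z p r₁ e ×
                          + d ≡ + r p r₁ (e ∸ 1) -ℤ + z *ℤ + r p r₁ e

  minimal-point-is-intermediate :
    Σ ℕ λ k → Σ ℕ λ z → 1 ≤ k × 2 * k ≤ t × suc z ≤ Z p r₁ (2 * k) ×
                        + d ≡ + r p r₁ (2 * k ∸ 1) -ℤ + z *ℤ + r p r₁ (2 * k)
  minimal-point-is-intermediate =
    let k , d≤rₒ , rₑ₊₁<d = odd-crossing
        z , suc-z≤Zₑ , d≡ = intermediate-remainder k d≤rₒ rₑ₊₁<d
    in  suc k , subst (Claim (suc k)) (sym (*-suc 2 k))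
                      (z , s≤s z≤n , even-index-bound k d≤rₒ , suc-z≤Zₑ , d≡)

module _ {q r₁ d : ℕ} (u a b : ℤ) (p∣ur₁-1 : + suc q ∣ u *ℤ + r₁ -ℤ 1ℤ)
         (b-a≡d : b -ℤ a ≡ + d) (X≤Y : ⟨ u *ℤ a ⟩ suc q ≤ ⟨ u *ℤ b ⟩ suc q) where

  private
    X = ⟨ u *ℤ a ⟩ suc q
    Y = ⟨ u *ℤ b ⟩ suc q

  residue-gap-on-lattice : Λ (+ suc q) (+ r₁) (+ (Y ∸ X)) (+ d)
  residue-gap-on-lattice = mkΛ (subst (+ suc q ∣_) d-r₁S≡
    (∣m∣n⇒∣m-n (∣n⇒∣m*n (+ r₁) (∣m∣n⇒∣m-n (⟨⟩-congruence (u *ℤ b)) (⟨⟩-congruence (u *ℤ a))))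
               (∣n⇒∣m*n (b -ℤ a) p∣ur₁-1)))
    where
    identity : ∀ u a b c x y → c *ℤ ((u *ℤ b -ℤ y) -ℤ (u *ℤ a -ℤ x)) -ℤ (b -ℤ a) *ℤ (u *ℤ c -ℤ 1ℤ)
                             ≡ (b -ℤ a) -ℤ c *ℤ (y -ℤ x)
    identity = solveℤ-∀
    d-r₁S≡ : + r₁ *ℤ ((u *ℤ b -ℤ + Y) -ℤ (u *ℤ a -ℤ + X)) -ℤ (b -ℤ a) *ℤ (u *ℤ + r₁ -ℤ 1ℤ)
             ≡ + d -ℤ + r₁ *ℤ + (Y ∸ X)
    d-r₁S≡ = trans (identity u a b (+ r₁) (+ X) (+ Y))
                   (cong₂ (λ D T → D -ℤ + r₁ *ℤ T) b-a≡d (+m-+n≡+[m∸n] X≤Y))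

  residue-gap-minimal : (∀ n → a <ℤ n → n <ℤ b → X ⊔ Y < ⟨ u *ℤ n ⟩ suc q) →
                        ∀ {x y} → 0 < y → y < d → x ≤ Y ∸ X → ¬ Λ (+ suc q) (+ r₁) (+ x) (+ y)
  residue-gap-minimal gap {x} {y} 0<y y<d x≤Y-X (mkΛ p∣y-r₁x) =
    <⇒≱ (gap (a +ℤ + y) a<a+y a+y<b)
        (subst (_≤ X ⊔ Y) (sym ⟨u[a+y]⟩≡X+x) (≤-trans X+x≤Y (m≤n⊔m X Y)))
    where
    X+x≤Y : X + x ≤ Y
    X+x≤Y = subst (X + x ≤_) (m+[n∸m]≡n X≤Y) (+-monoʳ-≤ X x≤Y-X)
    identity : ∀ u a y c X x → (u *ℤ a -ℤ X) +ℤ u *ℤ (y -ℤ c *ℤ x) +ℤ x *ℤ (u *ℤ c -ℤ 1ℤ)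
                             ≡ u *ℤ (a +ℤ y) -ℤ (X +ℤ x)
    identity = solveℤ-∀
    p∣u[a+y]-[X+x] : + suc q ∣ u *ℤ (a +ℤ + y) -ℤ + (X + x)
    p∣u[a+y]-[X+x] =
      subst (+ suc q ∣_) (trans (identity u a (+ y) (+ r₁) (+ X) (+ x))
                                (cong (λ z → u *ℤ (a +ℤ + y) -ℤ z) (sym (ℤ.pos-+ X x))))
        (∣m∣n⇒∣m+n (∣m∣n⇒∣m+n (⟨⟩-congruence (u *ℤ a)) (∣n⇒∣m*n u p∣y-r₁x)) (∣n⇒∣m*n (+ x) p∣ur₁-1))
    ⟨u[a+y]⟩≡X+x : ⟨ u *ℤ (a +ℤ + y) ⟩ suc q ≡ X + x
    ⟨u[a+y]⟩≡X+x =
      ⟨⟩-unique (u *ℤ (a +ℤ + y)) (≤-<-trans X+x≤Y (n%ℕd<d (u *ℤ b) (suc q))) p∣u[a+y]-[X+x]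
    a<a+y : a <ℤ a +ℤ + y
    a<a+y = subst (_<ℤ a +ℤ + y) (ℤ.+-identityʳ a) (ℤ.+-monoʳ-< a (+<+ 0<y))
    a+y<b : a +ℤ + y <ℤ b
    a+y<b = subst (a +ℤ + y <ℤ_) (trans (cong (a +ℤ_) (sym b-a≡d)) (a+[b-a]≡b a b))
                  (ℤ.+-monoʳ-< a (+<+ y<d))
      where
      a+[b-a]≡b : ∀ a b → a +ℤ (b -ℤ a) ≡ b
      a+[b-a]≡b = solveℤ-∀

lemma11 : (p : ℕ) → 3 ≤ p → (u : ℤ) → Coprime ∣ u ∣ p →
          (r1 : ℕ) → 0 < r1 → r1 < p → (+ p) ∣ℤ ((u *ℤ + r1) -ℤ + 1) →
          (t : ℕ) → r p r1 t ≡ 1 →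
          (a b : ℤ) → a <ℤ b → + 1 <ℤ (b -ℤ a) → (b -ℤ a) <ℤ + p →
          ((n : ℤ) → a <ℤ n → n <ℤ b →
            (⟨ u *ℤ a ⟩ p) ⊔ (⟨ u *ℤ b ⟩ p) < ⟨ u *ℤ n ⟩ p) →
          ⟨ u *ℤ a ⟩ p < ⟨ u *ℤ b ⟩ p →
          Σ ℕ (λ k → Σ ℕ (λ z →
            1 ≤ k × 2 * k ≤ t × suc z ≤ Z p r1 (2 * k) ×
            (b -ℤ a) ≡ (+ r p r1 (2 * k ∸ 1)) -ℤ (+ z *ℤ + r p r1 (2 * k))))
lemma11 p (s≤s 2≤q) u _ r1 0<r1 _ p∣ur1-1 t rₜ≡1 a b _ 1<b-a _ gap X<Y
  with b -ℤ a in b-a≡d | 1<b-a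
... | + d | +<+ 1<d =
  minimal-point-is-intermediate (s≤s (<⇒≤ 2≤q)) rₜ≡1 0<r1 1<d (m<n⇒0<n∸m X<Y)
    (residue-gap-on-lattice u a b (∣ᵤ⇒∣ p∣ur1-1) b-a≡d (<⇒≤ X<Y))
    (residue-gap-minimal u a b (∣ᵤ⇒∣ p∣ur1-1) b-a≡d (<⇒≤ X<Y) gap)
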